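{- An algebra $(A,\rightarrow,\rightsquigarrow,1)$ of type $(2,2,0)$ is a commutative pseudo-BE algebra if and only if it satisfies, for all $x,y,z\in A$: $(Q_1)$ $(x\rightarrow 1)\rightsquigarrow y=(x\rightsquigarrow 1)\rightarrow y=y$; $(Q_2)$ $(x\rightarrow z)\rightsquigarrow(y\rightarrow z)=(z\rightarrow x)\rightsquigarrow(y\rightarrow x)$ and $(x\rightsquigarrow z)\rightarrow(y\rightsquigarrow z)=(z\rightsquigarrow x)\rightarrow(y\rightsquigarrow x)$; $(Q_3)$ $x\rightarrow(y\rightsquigarrow z)=y\rightsquigarrow(x\rightarrow z)$; $(Q_4)$ $x\rightarrow y=1$ iff $x\rightsquigarrow y=1$.
   Context: A pseudo-BE algebra is an algebra $(A,\rightarrow,\rightsquigarrow,1)$ of type $(2,2,0)$ such that for all $x,y,z\in A$: $x\rightarrow x=x\rightsquigarrow x=1$; $x\rightarrow 1=x\rightsquigarrow 1=1$; $1\rightarrow x=1\rightsquigarrow x=x$; $x\rightarrow(y\rightsquigarrow z)=y\rightsquigarrow(x\rightarrow z)$; $x\rightarrow y=1$ iff $x\rightsquigarrow y=1$. It is commutative if $(x\rightarrow y)\rightsquigarrow y=(y\rightarrow x)\rightsquigarrow x$ and $(x\rightsquigarrow y)\rightarrow y=(y\rightsquigarrow x)\rightarrow x$ for all $x,y\in A$. -}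

module Defs where

open import Level using (Level)
open import Data.Product using (_×_)
open import Relation.Binary.PropositionalEquality using (_≡_)

-- An algebra (A, →, ⇝, 1) of type (2,2,0): carrier A, binary ops _⇒_ (for →),
-- _⇝_ (for ⇝), constant one (for 1).  Equality is propositional equality.

_↔′_ : ∀ {a b} → Set a → Set b → Set _
P ↔′ Q = (P → Q) × (Q → P)

record IsPseudoBE {a : Level} (A : Set a) (_⇒_ _⇝_ : A → A → A) (one : A) : Set a where
  field
    refl⇒   : ∀ x → x ⇒ x ≡ one
    refl⇝   : ∀ x → x ⇝ x ≡ one
    top⇒    : ∀ x → x ⇒ one ≡ one
    top⇝    : ∀ x → x ⇝ one ≡ one
    left⇒   : ∀ x → one ⇒ x ≡ x
    left⇝   : ∀ x → one ⇝ x ≡ x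
    exch    : ∀ x y z → x ⇒ (y ⇝ z) ≡ y ⇝ (x ⇒ z)
    one-iff : ∀ x y → (x ⇒ y ≡ one) ↔′ (x ⇝ y ≡ one)

record IsCommutativePseudoBE {a : Level} (A : Set a) (_⇒_ _⇝_ : A → A → A) (one : A) : Set a where
  field
    isPseudoBE : IsPseudoBE A _⇒_ _⇝_ one
    comm₁ : ∀ x y → (x ⇒ y) ⇝ y ≡ (y ⇒ x) ⇝ x
    comm₂ : ∀ x y → (x ⇝ y) ⇒ y ≡ (y ⇝ x) ⇒ x

record SatisfiesQ {a : Level} (A : Set a) (_⇒_ _⇝_ : A → A → A) (one : A) : Set a where
  field
    Q1a : ∀ x y → (x ⇒ one) ⇝ y ≡ y
    Q1b : ∀ x y → (x ⇝ one) ⇒ y ≡ y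
    Q2a : ∀ x y z → (x ⇒ z) ⇝ (y ⇒ z) ≡ (z ⇒ x) ⇝ (y ⇒ x)
    Q2b : ∀ x y z → (x ⇝ z) ⇒ (y ⇝ z) ≡ (z ⇝ x) ⇒ (y ⇝ x)
    Q3  : ∀ x y z → x ⇒ (y ⇝ z) ≡ y ⇝ (x ⇒ z)
    Q4  : ∀ x y → (x ⇒ y ≡ one) ↔′ (x ⇝ y ≡ one)

module Submission where

-- (Q3) and (Q4) are literally the exchange law and the "x → y = 1 iff
-- x ⇝ y = 1" axiom, so the work lies in relating (Q1), (Q2) to the
-- remaining pseudo-BE axioms and to commutativity.
--
-- * Commutativity and (Q2) are interderivable in any algebra with the
--   exchange law: (x → z) ⇝ (y → z) = y → ((x → z) ⇝ z), and conversely
--   commutativity is the instance y = 1 of (Q2) once 1 is a left unit.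
-- * (Q1) follows from "x → 1 = 1" and "1 ⇝ y = y" (and symmetrically).
-- * Conversely, from (Q1)–(Q4) alone we recover, in this order, the left
--   unit laws 1 → y = y and 1 ⇝ y = y, reflexivity x ⇝ x = 1 = x → x, and
--   the top laws x → 1 = 1 = x ⇝ 1.

open import Defs
open import Level using (Level)
open import Data.Product using (_×_; _,_; proj₁; proj₂)
open import Relation.Binary.PropositionalEquality
open ≡-Reasoning

module Laws {a : Level} {A : Set a} (_⇒_ _⇝_ : A → A → A) (one : A) where

  Exchange : Set a
  Exchange = ∀ x y z → x ⇒ (y ⇝ z) ≡ y ⇝ (x ⇒ z)

  -- With exchange, the first commutativity law yields the first half of (Q2):
  -- both sides of (Q2) equal y → ((x → z) ⇝ z), resp. y → ((z → x) ⇝ x).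
  comm⇝⇒Q2⇝ : Exchange →
    (∀ x y → (x ⇒ y) ⇝ y ≡ (y ⇒ x) ⇝ x) →
    ∀ x y z → (x ⇒ z) ⇝ (y ⇒ z) ≡ (z ⇒ x) ⇝ (y ⇒ x)
  comm⇝⇒Q2⇝ exch comm x y z = begin
    (x ⇒ z) ⇝ (y ⇒ z)   ≡⟨ exch y (x ⇒ z) z ⟨
    y ⇒ ((x ⇒ z) ⇝ z)   ≡⟨ cong (y ⇒_) (comm x z) ⟩
    y ⇒ ((z ⇒ x) ⇝ x)   ≡⟨ exch y (z ⇒ x) x ⟩
    (z ⇒ x) ⇝ (y ⇒ x)   ∎

  comm⇒⇒Q2⇒ : Exchange →
    (∀ x y → (x ⇝ y) ⇒ y ≡ (y ⇝ x) ⇒ x) →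
    ∀ x y z → (x ⇝ z) ⇒ (y ⇝ z) ≡ (z ⇝ x) ⇒ (y ⇝ x)
  comm⇒⇒Q2⇒ exch comm x y z = begin
    (x ⇝ z) ⇒ (y ⇝ z)   ≡⟨ exch (x ⇝ z) y z ⟩
    y ⇝ ((x ⇝ z) ⇒ z)   ≡⟨ cong (y ⇝_) (comm x z) ⟩
    y ⇝ ((z ⇝ x) ⇒ x)   ≡⟨ exch (z ⇝ x) y x ⟨
    (z ⇝ x) ⇒ (y ⇝ x)   ∎

  -- If 1 is a left unit for →, the first half of (Q2) at y = 1 is the first
  -- commutativity law.
  Q2⇝⇒comm⇝ : (∀ x → one ⇒ x ≡ x) →
    (∀ x y z → (x ⇒ z) ⇝ (y ⇒ z) ≡ (z ⇒ x) ⇝ (y ⇒ x)) →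
    ∀ x y → (x ⇒ y) ⇝ y ≡ (y ⇒ x) ⇝ x
  Q2⇝⇒comm⇝ left⇒ q2 x y = begin
    (x ⇒ y) ⇝ y           ≡⟨ cong ((x ⇒ y) ⇝_) (left⇒ y) ⟨
    (x ⇒ y) ⇝ (one ⇒ y)   ≡⟨ q2 x one y ⟩
    (y ⇒ x) ⇝ (one ⇒ x)   ≡⟨ cong ((y ⇒ x) ⇝_) (left⇒ x) ⟩
    (y ⇒ x) ⇝ x           ∎

  Q2⇒⇒comm⇒ : (∀ x → one ⇝ x ≡ x) →
    (∀ x y z → (x ⇝ z) ⇒ (y ⇝ z) ≡ (z ⇝ x) ⇒ (y ⇝ x)) →
    ∀ x y → (x ⇝ y) ⇒ y ≡ (y ⇝ x) ⇒ x
  Q2⇒⇒comm⇒ left⇝ q2 x y = begin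
    (x ⇝ y) ⇒ y           ≡⟨ cong ((x ⇝ y) ⇒_) (left⇝ y) ⟨
    (x ⇝ y) ⇒ (one ⇝ y)   ≡⟨ q2 x one y ⟩
    (y ⇝ x) ⇒ (one ⇝ x)   ≡⟨ cong ((y ⇝ x) ⇒_) (left⇝ x) ⟩
    (y ⇝ x) ⇒ x           ∎

  top-left⇒Q1⇝ : (∀ x → x ⇒ one ≡ one) → (∀ y → one ⇝ y ≡ y) →
    ∀ x y → (x ⇒ one) ⇝ y ≡ y
  top-left⇒Q1⇝ top⇒ left⇝ x y = trans (cong (_⇝ y) (top⇒ x)) (left⇝ y)

  top-left⇒Q1⇒ : (∀ x → x ⇝ one ≡ one) → (∀ y → one ⇒ y ≡ y) →
    ∀ x y → (x ⇝ one) ⇒ y ≡ y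
  top-left⇒Q1⇒ top⇝ left⇒ x y = trans (cong (_⇒ y) (top⇝ x)) (left⇒ y)

module FromQ {a : Level} {A : Set a} {_⇒_ _⇝_ : A → A → A} {one : A}
             (Q : SatisfiesQ A _⇒_ _⇝_ one) where
  open SatisfiesQ Q

  -- (Q1) at y = 1 says (x → 1) ⇝ 1 = 1, hence (x → 1) → 1 = 1 by (Q4);
  -- then (Q1) at x → 1 rewrites ((x → 1) → 1) ⇝ y = y to 1 ⇝ y = y.
  left⇝ : ∀ y → one ⇝ y ≡ y
  left⇝ y = subst (λ w → w ⇝ y ≡ y) top (Q1a (y ⇒ one) y)
    where
      top : (y ⇒ one) ⇒ one ≡ one
      top = proj₂ (Q4 (y ⇒ one) one) (Q1a y one)

  left⇒ : ∀ y → one ⇒ y ≡ y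
  left⇒ y = subst (λ w → w ⇒ y ≡ y) top (Q1b (y ⇝ one) y)
    where
      top : (y ⇝ one) ⇝ one ≡ one
      top = proj₁ (Q4 (y ⇝ one) one) (Q1b y one)

  -- (Q2) with x = y = 1 turns z ⇝ z into (z → 1) ⇝ 1, which is 1 by (Q1).
  refl⇝ : ∀ z → z ⇝ z ≡ one
  refl⇝ z = begin
    z ⇝ z                   ≡⟨ cong₂ _⇝_ (left⇒ z) (left⇒ z) ⟨
    (one ⇒ z) ⇝ (one ⇒ z)   ≡⟨ Q2a one one z ⟩
    (z ⇒ one) ⇝ (one ⇒ one) ≡⟨ cong ((z ⇒ one) ⇝_) (left⇒ one) ⟩
    (z ⇒ one) ⇝ one         ≡⟨ Q1a z one ⟩
    one                     ∎

  refl⇒ : ∀ z → z ⇒ z ≡ one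
  refl⇒ z = proj₂ (Q4 z z) (refl⇝ z)

  -- (Q1) writes x → 1 as (x → 1) ⇝ (x → 1), which is 1 by reflexivity.
  top⇒ : ∀ x → x ⇒ one ≡ one
  top⇒ x = trans (sym (Q1a x (x ⇒ one))) (refl⇝ (x ⇒ one))

  top⇝ : ∀ x → x ⇝ one ≡ one
  top⇝ x = trans (sym (Q1b x (x ⇝ one))) (refl⇒ (x ⇝ one))

commutative⇒Q : {a : Level} {A : Set a} {_⇒_ _⇝_ : A → A → A} {one : A} →
  IsCommutativePseudoBE A _⇒_ _⇝_ one → SatisfiesQ A _⇒_ _⇝_ one
commutative⇒Q {_⇒_ = _⇒_} {_⇝_} {one} C = record
  { Q1a = top-left⇒Q1⇝ top⇒ left⇝
  ; Q1b = top-left⇒Q1⇒ top⇝ left⇒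
  ; Q2a = comm⇝⇒Q2⇝ exch comm₁
  ; Q2b = comm⇒⇒Q2⇒ exch comm₂
  ; Q3  = exch
  ; Q4  = one-iff
  }
  where
    open Laws _⇒_ _⇝_ one
    open IsCommutativePseudoBE C
    open IsPseudoBE isPseudoBE

Q⇒commutative : {a : Level} {A : Set a} {_⇒_ _⇝_ : A → A → A} {one : A} →
  SatisfiesQ A _⇒_ _⇝_ one → IsCommutativePseudoBE A _⇒_ _⇝_ one
Q⇒commutative {_⇒_ = _⇒_} {_⇝_} {one} Q = record
  { isPseudoBE = record
    { refl⇒ = refl⇒ ; refl⇝ = refl⇝ ; top⇒ = top⇒ ; top⇝ = top⇝
    ; left⇒ = left⇒ ; left⇝ = left⇝ ; exch = Q3 ; one-iff = Q4 }
  ; comm₁ = Q2⇝⇒comm⇝ left⇒ Q2a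
  ; comm₂ = Q2⇒⇒comm⇒ left⇝ Q2b
  }
  where
    open Laws _⇒_ _⇝_ one
    open SatisfiesQ Q
    open FromQ Q

theorem4p14 : {a : Level} (A : Set a) (_⇒_ _⇝_ : A → A → A) (one : A) →
    (IsCommutativePseudoBE A _⇒_ _⇝_ one → SatisfiesQ A _⇒_ _⇝_ one) ×
    (SatisfiesQ A _⇒_ _⇝_ one → IsCommutativePseudoBE A _⇒_ _⇝_ one)
theorem4p14 A _⇒_ _⇝_ one = commutative⇒Q , Q⇒commutative
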